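{- The class $\mathsf{DR}\upharpoonright\mathbb{O}$ is closed under composition.
   Context: $\mathbb{O}$ is an elementary recursive ordinal notation system (on $\mathbb{N}$) for some $\varepsilon$-number, closed under elementary recursive $+,\cdot,\omega^{\cdot}$ and satisfying the basic laws of ordinal arithmetic; $\mathbb{O}_\alpha=\{\beta\in\mathbb{O}\mid\beta<\alpha\}$. For $\alpha\in\mathbb{O}$, $g_0\colon\mathbb{N}\to\mathbb{N}\times\mathbb{O}_\alpha$, $g_1\colon\mathbb{N}^2\times\mathbb{O}\to\mathbb{N}\times\mathbb{O}$, $g_2\colon\mathbb{N}\to\mathbb{N}$, $D_\alpha(g_0,g_1,g_2)(x)=g_2(y_s)$ where $(y_0,\alpha_0)=g_0(x)$, $(y_{i+1},\alpha_{i+1})=g_1(x,y_i,\alpha_i)$ and $s$ is least with $\alpha_s\le\alpha_{s+1}$ (analogously for several arguments). $\mathsf{DR}\upharpoonright\mathbb{O}$ is the least class containing the elementary recursive functions and closed under: $g_0,g_1,g_2$ in the class and $\alpha\in\mathbb{O}$ imply $D_\alpha(g_0,g_1,g_2)$ in the class. -}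

module Defs where

open import Data.Nat using (ℕ; zero; suc; _+_; _*_; _∸_; _<_)
open import Data.Fin using (Fin)
open import Data.Vec using (Vec; []; _∷_; lookup; _++_; head)
open import Data.Product using (Σ; _×_; _,_; proj₁; proj₂)
open import Data.Sum using (_⊎_)
open import Relation.Binary.PropositionalEquality using (_≡_)
open import Relation.Nullary using (¬_)
open import Function.Bundles using (_⇔_)
open import Induction.WellFounded using (Acc)

sumBelow : ℕ → (ℕ → ℕ) → ℕ
sumBelow zero    f = 0
sumBelow (suc y) f = sumBelow y f + f y

prodBelow : ℕ → (ℕ → ℕ) → ℕ
prodBelow zero    f = 1
prodBelow (suc y) f = prodBelow y f * f y

data Elem : (k : ℕ) → (Vec ℕ k → ℕ) → Set where
  e-zero  : ∀ {k} → Elem k (λ _ → 0)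
  e-suc   : Elem 1 (λ v → suc (head v))
  e-proj  : ∀ {k} (i : Fin k) → Elem k (λ v → lookup v i)
  e-add   : Elem 2 (λ v → lookup v Fin.zero + lookup v (Fin.suc Fin.zero))
  e-monus : Elem 2 (λ v → lookup v Fin.zero ∸ lookup v (Fin.suc Fin.zero))
  e-comp  : ∀ {k m} {f : Vec ℕ m → ℕ} {gs : Fin m → Vec ℕ k → ℕ} →
            Elem m f → (∀ i → Elem k (gs i)) →
            Elem k (λ v → f (Data.Vec.tabulate (λ i → gs i v)))
  e-bsum  : ∀ {k} {f : Vec ℕ (suc k) → ℕ} → Elem (suc k) f →
            Elem (suc k) (λ { (y ∷ v) → sumBelow y (λ i → f (i ∷ v)) })
  e-bprod : ∀ {k} {f : Vec ℕ (suc k) → ℕ} → Elem (suc k) f →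
            Elem (suc k) (λ { (y ∷ v) → prodBelow y (λ i → f (i ∷ v)) })
  e-ext   : ∀ {k} {f g : Vec ℕ k → ℕ} → Elem k f → (∀ v → f v ≡ g v) → Elem k g

ElemRel : (k : ℕ) → (Vec ℕ k → Set) → Set
ElemRel k P = Σ (Vec ℕ k → ℕ) λ χ → Elem k χ × (∀ v → P v ⇔ (χ v ≡ 0))

record OrdNotation : Set₁ where
  field
    InO  : ℕ → Set
    _≺_  : ℕ → ℕ → Set
    0O   : ℕ
    _⊕_  : ℕ → ℕ → ℕ
    _⊗_  : ℕ → ℕ → ℕ
    ω^_  : ℕ → ℕ

  _≼_ : ℕ → ℕ → Set
  β ≼ γ = β ≺ γ ⊎ β ≡ γ

  1O : ℕ
  1O = ω^ 0O

  field
    InO-elem : ElemRel 1 (λ v → InO (head v))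
    ≺-elem   : ElemRel 2 (λ v → lookup v Fin.zero ≺ lookup v (Fin.suc Fin.zero))
    ⊕-elem   : Elem 2 (λ v → lookup v Fin.zero ⊕ lookup v (Fin.suc Fin.zero))
    ⊗-elem   : Elem 2 (λ v → lookup v Fin.zero ⊗ lookup v (Fin.suc Fin.zero))
    ω^-elem  : Elem 1 (λ v → ω^ (head v))
    ≺-irrefl : ∀ {β} → InO β → ¬ (β ≺ β)
    ≺-trans  : ∀ {β γ δ} → InO β → InO γ → InO δ → β ≺ γ → γ ≺ δ → β ≺ δ
    ≺-tri    : ∀ {β γ} → InO β → InO γ → β ≺ γ ⊎ β ≡ γ ⊎ γ ≺ β
    ≺-wf     : ∀ {β} → InO β → Acc (λ a b → InO a × a ≺ b) β
    0-in     : InO 0O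
    ⊕-in     : ∀ {β γ} → InO β → InO γ → InO (β ⊕ γ)
    ⊗-in     : ∀ {β γ} → InO β → InO γ → InO (β ⊗ γ)
    ω^-in    : ∀ {β} → InO β → InO (ω^ β)
    0-least  : ∀ {β} → InO β → 0O ≼ β
    ⊕-idʳ    : ∀ {β} → InO β → β ⊕ 0O ≡ β
    ⊕-idˡ    : ∀ {β} → InO β → 0O ⊕ β ≡ β
    ⊕-assoc  : ∀ {β γ δ} → InO β → InO γ → InO δ → (β ⊕ γ) ⊕ δ ≡ β ⊕ (γ ⊕ δ)
    ⊕-monoʳ  : ∀ {β γ δ} → InO β → InO γ → InO δ → γ ≺ δ → (β ⊕ γ) ≺ (β ⊕ δ)
    ⊕-monoˡ  : ∀ {β γ δ} → InO β → InO γ → InO δ → γ ≼ δ → (γ ⊕ β) ≼ (δ ⊕ β)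
    ⊕-sub    : ∀ {β γ} → InO β → InO γ → β ≼ γ → Σ ℕ λ δ → InO δ × (β ⊕ δ ≡ γ)
    ⊗-zeroʳ  : ∀ {β} → InO β → β ⊗ 0O ≡ 0O
    ⊗-zeroˡ  : ∀ {β} → InO β → 0O ⊗ β ≡ 0O
    ⊗-idʳ    : ∀ {β} → InO β → β ⊗ 1O ≡ β
    ⊗-idˡ    : ∀ {β} → InO β → 1O ⊗ β ≡ β
    ⊗-distribˡ : ∀ {β γ δ} → InO β → InO γ → InO δ → β ⊗ (γ ⊕ δ) ≡ (β ⊗ γ) ⊕ (β ⊗ δ)
    ⊗-assoc  : ∀ {β γ δ} → InO β → InO γ → InO δ → (β ⊗ γ) ⊗ δ ≡ β ⊗ (γ ⊗ δ)
    ⊗-monoʳ  : ∀ {β γ δ} → InO β → InO γ → InO δ → 0O ≺ β → γ ≺ δ → (β ⊗ γ) ≺ (β ⊗ δ)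
    ⊗-monoˡ  : ∀ {β γ δ} → InO β → InO γ → InO δ → γ ≼ δ → (γ ⊗ β) ≼ (δ ⊗ β)
    ω^-⊕     : ∀ {β γ} → InO β → InO γ → ω^ (β ⊕ γ) ≡ (ω^ β) ⊗ (ω^ γ)
    ω^-mono  : ∀ {β γ} → InO β → InO γ → β ≺ γ → (ω^ β) ≺ (ω^ γ)
    ω^-addprinc : ∀ {β γ δ} → InO β → InO γ → InO δ →
                  β ≺ (ω^ γ) → δ ≺ (ω^ γ) → (β ⊕ δ) ≺ (ω^ γ)

module _ (O : OrdNotation) where
  open OrdNotation O

  DSeq : ∀ {k} → (g0y g0o : Vec ℕ k → ℕ) → (g1y g1o : Vec ℕ (k + 2) → ℕ) →
         Vec ℕ k → ℕ → ℕ × ℕ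
  DSeq g0y g0o g1y g1o x zero    = g0y x , g0o x
  DSeq g0y g0o g1y g1o x (suc i) =
    let p = DSeq g0y g0o g1y g1o x i in
    g1y (x ++ proj₁ p ∷ proj₂ p ∷ []) , g1o (x ++ proj₁ p ∷ proj₂ p ∷ [])

  DValue : ∀ {k} → (g0y g0o : Vec ℕ k → ℕ) → (g1y g1o : Vec ℕ (k + 2) → ℕ) →
           (g2 : Vec ℕ 1 → ℕ) → Vec ℕ k → ℕ → Set
  DValue g0y g0o g1y g1o g2 x z =
    Σ ℕ λ s →
      (∀ i → i < s → ¬ (ord i ≼ ord (suc i))) ×
      (ord s ≼ ord (suc s)) ×
      (z ≡ g2 (proj₁ (DSeq g0y g0o g1y g1o x s) ∷ []))
    where
    ord : ℕ → ℕ
    ord i = proj₂ (DSeq g0y g0o g1y g1o x i)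

  data DR : (k : ℕ) → (Vec ℕ k → ℕ) → Set where
    dr-elem : ∀ {k} {f : Vec ℕ k → ℕ} → Elem k f → DR k f
    dr-D    : ∀ {k} {g0y g0o : Vec ℕ k → ℕ} {g1y g1o : Vec ℕ (k + 2) → ℕ}
                {g2 : Vec ℕ 1 → ℕ} {f : Vec ℕ k → ℕ} →
              (α : ℕ) → InO α →
              DR k g0y → DR k g0o → DR (k + 2) g1y → DR (k + 2) g1o → DR 1 g2 →
              -- g0 : ℕ^k → ℕ × 𝕆_α
              (∀ x → InO (g0o x) × (g0o x ≺ α)) →
              -- g1 : ℕ^k × ℕ × 𝕆 → ℕ × 𝕆
              (∀ x y β → InO β → InO (g1o (x ++ y ∷ β ∷ []))) →
              (∀ x → DValue g0y g0o g1y g1o g2 x (f x)) →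
              DR k f

module Submission where

-- A function in DR ↾ 𝕆 comes with a derivation tree, and we argue by induction on its
-- height.  Precomposition with elementary maps does not change the height.  Definition by
-- cases, x ↦ if c x = 0 then p (F x) else q (G x), is a D-recursion bounded by α₁ ⊕ α₂ that
-- runs the recursion of F or of G, chosen by c x, on states tagged with the branch.
-- Substitution, x ↦ H (g x, x), is a D-recursion bounded by ω^α that runs the recursion of
-- g on states ⟨y, β⟩ with ordinals ω^β; once the run of g stops (β ≼ β′) it outputs
-- H (g2 y, x) with ordinal 0.  The step functions of both new recursions are built from the
-- components of the given ones, which have smaller height, by the same two constructions.
-- Composition is then iterated substitution.

open import Data.Empty using (⊥-elim)
open import Data.Fin using (Fin; zero; suc; #_; _↑ˡ_; _↑ʳ_; splitAt)
open import Data.Nat using (ℕ; zero; suc; _+_; _*_; _∸_; _<_; _≤_; _⊓_; _⊔_; z≤n; s≤s; _<?_)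
open import Data.Nat.Properties
open import Data.Product using (Σ; _×_; _,_; proj₁; proj₂; map₁; uncurry)
open import Data.Sum using (_⊎_; inj₁; inj₂; [_,_]′)
open import Data.Vec using (Vec; []; _∷_; head; tail; lookup; tabulate; _++_; replicate)
open import Data.Vec.Properties
  using (tabulate∘lookup; lookup∘tabulate; tabulate-cong; lookup-++ˡ; lookup-++ʳ; lookup-splitAt)
open import Function using (id; _∘_)
open import Function.Bundles using (Equivalence)
open import Relation.Binary.PropositionalEquality
open import Relation.Nullary using (yes; no; ¬_)

open import Defs

Elem₁ : (ℕ → ℕ) → Set
Elem₁ f = Elem 1 (λ v → f (head v))

Elem₂ : (ℕ → ℕ → ℕ) → Set
Elem₂ f = Elem 2 (λ v → f (lookup v zero) (lookup v (suc zero)))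

sumBelow-const : ∀ n c → sumBelow n (λ _ → c) ≡ n * c
sumBelow-const zero    c = refl
sumBelow-const (suc n) c = trans (cong (_+ c) (sumBelow-const n c)) (+-comm (n * c) c)

*-elem : Elem₂ _*_
*-elem = e-ext (e-bsum (e-proj (suc zero))) λ { (a ∷ b ∷ []) → sumBelow-const a b }

const-elem : ∀ {k} n → Elem k (λ _ → n)
const-elem zero    = e-zero
const-elem (suc n) = e-comp e-suc (λ _ → const-elem n)

data Term (k : ℕ) : Set where
  var : Fin k → Term k
  lit : ℕ → Term k
  sum : Term k → Term (suc k) → Term k
  app : ∀ {n} {f : Vec ℕ n → ℕ} → Elem n f → (Fin n → Term k) → Term k

⟦_⟧ : ∀ {k} → Term k → Vec ℕ k → ℕ
⟦ var i ⟧     v = lookup v i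
⟦ lit n ⟧     v = n
⟦ sum b t ⟧   v = sumBelow (⟦ b ⟧ v) (λ i → ⟦ t ⟧ (i ∷ v))
⟦ app {f = f} _ ts ⟧ v = f (tabulate (λ i → ⟦ ts i ⟧ v))

⟦⟧-elem : ∀ {k} (t : Term k) → Elem k ⟦ t ⟧
⟦⟧-elem (var i)    = e-proj i
⟦⟧-elem (lit n)    = const-elem n
⟦⟧-elem {k} (sum b t) =
  e-ext (e-comp (e-bsum (⟦⟧-elem t)) bound-and-vars)
        (λ v → cong (λ w → sumBelow (⟦ b ⟧ v) (λ i → ⟦ t ⟧ (i ∷ w))) (tabulate∘lookup v))
  where
  bound-and-vars : (i : Fin (suc k)) → Elem k (λ v → lookup (⟦ b ⟧ v ∷ v) i)
  bound-and-vars zero    = ⟦⟧-elem b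
  bound-and-vars (suc i) = e-proj i
⟦⟧-elem (app e ts) = e-comp e (λ i → ⟦⟧-elem (ts i))

elem-by : ∀ {k} {f : Vec ℕ k → ℕ} (t : Term k) → (∀ v → ⟦ t ⟧ v ≡ f v) → Elem k f
elem-by t eq = e-ext (⟦⟧-elem t) eq

infixl 6 _+ᵗ_ _∸ᵗ_
infixl 7 _*ᵗ_

app₁ : ∀ {k} {f : Vec ℕ 1 → ℕ} → Elem 1 f → Term k → Term k
app₁ e t = app e (λ _ → t)

app₂ : ∀ {k} {f : Vec ℕ 2 → ℕ} → Elem 2 f → Term k → Term k → Term k
app₂ e t u = app e (lookup (t ∷ u ∷ []))

_+ᵗ_ _∸ᵗ_ _*ᵗ_ : ∀ {k} → Term k → Term k → Term k
t +ᵗ u = app₂ e-add t u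
t ∸ᵗ u = app₂ e-monus t u
t *ᵗ u = app₂ *-elem t u

if0_then_else_ : ℕ → ℕ → ℕ → ℕ
if0 zero  then a else b = a
if0 suc _ then a else b = b

if0-elem : Elem 3 (λ v → if0 lookup v (# 0) then lookup v (# 1) else lookup v (# 2))
if0-elem =
  elem-by (var (# 1) *ᵗ (lit 1 ∸ᵗ var (# 0)) +ᵗ var (# 2) *ᵗ (lit 1 ∸ᵗ (lit 1 ∸ᵗ var (# 0))))
  λ { (zero ∷ a ∷ b ∷ [])  → trans (cong₂ _+_ (*-identityʳ a) (*-zeroʳ b)) (+-identityʳ a)
    ; (suc c ∷ a ∷ b ∷ []) → trans (cong (λ d → a * d + b * (1 ∸ d)) (0∸n≡0 c))
                                   (trans (cong (_+ b * 1) (*-zeroʳ a)) (*-identityʳ b)) }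

if0-zero : ∀ {c a b} → c ≡ 0 → if0 c then a else b ≡ a
if0-zero refl = refl

if0-≢0 : ∀ {c a b} → ¬ (c ≡ 0) → if0 c then a else b ≡ b
if0-≢0 {zero}  c≢0 = ⊥-elim (c≢0 refl)
if0-≢0 {suc c} c≢0 = refl

if0-elim : ∀ (P : ℕ → Set) c {a b} → P a → P b → P (if0 c then a else b)
if0-elim P zero    Pa Pb = Pa
if0-elim P (suc _) Pa Pb = Pb

if0ᵗ_then_else_ : ∀ {k} → Term k → Term k → Term k → Term k
if0ᵗ c then t else u = app if0-elem (lookup (c ∷ t ∷ u ∷ []))

-- Cantor pairing

triangle : ℕ → ℕ
triangle n = sumBelow n suc

n≤triangle : ∀ n → n ≤ triangle n
n≤triangle zero    = z≤n
n≤triangle (suc n) = m≤n+m (suc n) (triangle n)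

triangle-mono-≤ : ∀ {m n} → m ≤ n → triangle m ≤ triangle n
triangle-mono-≤ {n = zero} z≤n = ≤-refl
triangle-mono-≤ {m} {suc n} m≤1+n with m≤n⇒m<n∨m≡n m≤1+n
... | inj₁ m<1+n = ≤-trans (triangle-mono-≤ (≤-pred m<1+n)) (m≤m+n (triangle n) (suc n))
... | inj₂ refl  = ≤-refl

sumBelow-indicator : ∀ {c} (f : ℕ → ℕ) → (∀ {i} → i < c → f i ≡ 1) → (∀ {i} → c ≤ i → f i ≡ 0) →
                     ∀ n → sumBelow n f ≡ n ⊓ c
sumBelow-indicator f f≡1 f≡0 zero = refl
sumBelow-indicator {c} f f≡1 f≡0 (suc n) with n <? c
... | yes n<c = begin
  sumBelow n f + f n ≡⟨ cong₂ _+_ (sumBelow-indicator f f≡1 f≡0 n) (f≡1 n<c) ⟩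
  n ⊓ c + 1          ≡⟨ cong (_+ 1) (m≤n⇒m⊓n≡m (<⇒≤ n<c)) ⟩
  n + 1              ≡⟨ +-comm n 1 ⟩
  suc n              ≡⟨ m≤n⇒m⊓n≡m n<c ⟨
  suc n ⊓ c          ∎
  where open ≡-Reasoning
... | no n≮c = begin
  sumBelow n f + f n ≡⟨ cong₂ _+_ (sumBelow-indicator f f≡1 f≡0 n) (f≡0 (≮⇒≥ n≮c)) ⟩
  n ⊓ c + 0          ≡⟨ +-identityʳ (n ⊓ c) ⟩
  n ⊓ c              ≡⟨ m≥n⇒m⊓n≡n (≮⇒≥ n≮c) ⟩
  c                  ≡⟨ m≥n⇒m⊓n≡n (m≤n⇒m≤1+n (≮⇒≥ n≮c)) ⟨
  suc n ⊓ c          ∎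
  where open ≡-Reasoning

pair : ℕ → ℕ → ℕ
pair a b = triangle (a + b) + a

-- diagonal z counts the i < z with triangle (suc i) ≤ z.
diagonal : ℕ → ℕ
diagonal z = sumBelow z (λ i → 1 ∸ (triangle (suc i) ∸ z))

unpair₁ unpair₂ : ℕ → ℕ
unpair₁ z = z ∸ triangle (diagonal z)
unpair₂ z = diagonal z ∸ unpair₁ z

diagonal-pair : ∀ a b → diagonal (pair a b) ≡ a + b
diagonal-pair a b = trans (sumBelow-indicator _ below above (pair a b)) (m≥n⇒m⊓n≡n s≤pair)
  where
  s : ℕ
  s = a + b
  s≤pair : s ≤ pair a b
  s≤pair = ≤-trans (n≤triangle s) (m≤m+n (triangle s) a)
  below : ∀ {i} → i < s → 1 ∸ (triangle (suc i) ∸ pair a b) ≡ 1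
  below i<s = cong (1 ∸_) (m≤n⇒m∸n≡0 (≤-trans (triangle-mono-≤ i<s) (m≤m+n (triangle s) a)))
  above : ∀ {i} → s ≤ i → 1 ∸ (triangle (suc i) ∸ pair a b) ≡ 0
  above s≤i = m≤n⇒m∸n≡0 (m<n⇒0<n∸m (≤-trans pair<triangle (triangle-mono-≤ (s≤s s≤i))))
    where
    pair<triangle : pair a b < triangle (suc s)
    pair<triangle = +-monoʳ-< (triangle s) (s≤s (m≤m+n a b))

unpair₁-pair : ∀ a b → unpair₁ (pair a b) ≡ a
unpair₁-pair a b =
  trans (cong (λ s → pair a b ∸ triangle s) (diagonal-pair a b)) (m+n∸m≡n (triangle (a + b)) a)

unpair₂-pair : ∀ a b → unpair₂ (pair a b) ≡ b
unpair₂-pair a b = trans (cong₂ _∸_ (diagonal-pair a b) (unpair₁-pair a b)) (m+n∸m≡n a b)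

triangle-elem : Elem₁ triangle
triangle-elem = elem-by (sum (var zero) (lit 1 +ᵗ var zero)) λ { (n ∷ []) → refl }

pair-elem : Elem₂ pair
pair-elem =
  elem-by (app₁ triangle-elem (var (# 0) +ᵗ var (# 1)) +ᵗ var (# 0)) λ { (a ∷ b ∷ []) → refl }

diagonal-elem : Elem₁ diagonal
diagonal-elem =
  elem-by (sum (var zero) (lit 1 ∸ᵗ (app₁ triangle-elem (lit 1 +ᵗ var (# 0)) ∸ᵗ var (# 1))))
          λ { (z ∷ []) → refl }

unpair₁-elem : Elem₁ unpair₁
unpair₁-elem =
  elem-by (var zero ∸ᵗ app₁ triangle-elem (app₁ diagonal-elem (var zero))) λ { (z ∷ []) → refl }

unpair₂-elem : Elem₁ unpair₂
unpair₂-elem =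
  elem-by (app₁ diagonal-elem (var zero) ∸ᵗ app₁ unpair₁-elem (var zero)) λ { (z ∷ []) → refl }

record ElemMap (k m : ℕ) (h : Vec ℕ k → Vec ℕ m) : Set where
  constructor elem-map
  field elem-lookup : ∀ i → Elem k (λ x → lookup (h x) i)
open ElemMap

elem-∘ : ∀ {k m} {f : Vec ℕ m → ℕ} {h : Vec ℕ k → Vec ℕ m} →
         Elem m f → ElemMap k m h → Elem k (f ∘ h)
elem-∘ {f = f} ef eh = e-ext (e-comp ef (elem-lookup eh)) (λ x → cong f (tabulate∘lookup _))

id-elem : ∀ {k} → ElemMap k k id
id-elem = elem-map e-proj

∘-elem : ∀ {k m n} {h : Vec ℕ m → Vec ℕ n} {g : Vec ℕ k → Vec ℕ m} →
         ElemMap m n h → ElemMap k m g → ElemMap k n (h ∘ g)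
∘-elem eh eg = elem-map λ i → elem-∘ (elem-lookup eh i) eg

[]-elem : ∀ {k} → ElemMap k 0 (λ _ → [])
[]-elem = elem-map λ ()

∷-elem : ∀ {k m} {f : Vec ℕ k → ℕ} {h : Vec ℕ k → Vec ℕ m} →
         Elem k f → ElemMap k m h → ElemMap k (suc m) (λ x → f x ∷ h x)
∷-elem ef eh = elem-map λ { zero → ef ; (suc i) → elem-lookup eh i }

++-elem : ∀ {k m n} {h : Vec ℕ k → Vec ℕ m} {h′ : Vec ℕ k → Vec ℕ n} →
          ElemMap k m h → ElemMap k n h′ → ElemMap k (m + n) (λ x → h x ++ h′ x)
++-elem {m = m} {h = h} {h′} eh eh′ = elem-map component
  where
  lookup-++ : ∀ i {c} → splitAt m i ≡ c → ∀ x → lookup (h x ++ h′ x) i ≡ [ lookup (h x) , lookup (h′ x) ]′ c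
  lookup-++ i split x = trans (lookup-splitAt m (h x) (h′ x) i) (cong [ lookup (h x) , lookup (h′ x) ]′ split)
  component : ∀ i → Elem _ (λ x → lookup (h x ++ h′ x) i)
  component i with splitAt m i in split
  ... | inj₁ j = e-ext (elem-lookup eh j) (sym ∘ lookup-++ i split)
  ... | inj₂ j = e-ext (elem-lookup eh′ j) (sym ∘ lookup-++ i split)

tail-elem : ∀ {k} → ElemMap (suc k) k tail
tail-elem = elem-map λ i → e-ext (e-proj (suc i)) λ { (a ∷ x) → refl }

select : ∀ {k m} → (Fin m → Fin k) → Vec ℕ k → Vec ℕ m
select ρ x = tabulate (λ i → lookup x (ρ i))

select-elem : ∀ {k m} (ρ : Fin m → Fin k) → ElemMap k m (select ρ)
select-elem ρ = elem-map λ i → e-ext (e-proj (ρ i)) λ x → sym (lookup∘tabulate (lookup x ∘ ρ) i)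

select-↑ˡ-++ : ∀ {m n} (w : Vec ℕ m) (y : Vec ℕ n) → select (_↑ˡ n) (w ++ y) ≡ w
select-↑ˡ-++ w y = trans (tabulate-cong (lookup-++ˡ w y)) (tabulate∘lookup w)

args : ∀ {k} → Vec ℕ (k + 2) → Vec ℕ k
args = select (_↑ˡ 2)

state ordinal : ∀ {k} → Vec ℕ (k + 2) → ℕ
state   {k} X = lookup X (k ↑ʳ zero)
ordinal {k} X = lookup X (k ↑ʳ suc zero)

args-elem : ∀ {k} → ElemMap (k + 2) k args
args-elem = select-elem (_↑ˡ 2)

state-elem : ∀ {k} → Elem (k + 2) (state {k})
state-elem {k} = e-proj (k ↑ʳ zero)

ordinal-elem : ∀ {k} → Elem (k + 2) (ordinal {k})
ordinal-elem {k} = e-proj (k ↑ʳ suc zero)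

module _ {k} (x : Vec ℕ k) (z γ : ℕ) where
  args-++ : args (x ++ z ∷ γ ∷ []) ≡ x
  args-++ = select-↑ˡ-++ x (z ∷ γ ∷ [])

  state-++ : state (x ++ z ∷ γ ∷ []) ≡ z
  state-++ = lookup-++ʳ x (z ∷ γ ∷ []) zero

  ordinal-++ : ordinal (x ++ z ∷ γ ∷ []) ≡ γ
  ordinal-++ = lookup-++ʳ x (z ∷ γ ∷ []) (suc zero)

module Closure (O : OrdNotation) where
  open OrdNotation O

  ≺⇒¬≽ : ∀ {β γ} → InO β → InO γ → γ ≺ β → ¬ (β ≼ γ)
  ≺⇒¬≽ β∈O γ∈O γ≺β (inj₁ β≺γ) = ≺-irrefl β∈O (≺-trans β∈O γ∈O β∈O β≺γ γ≺β)
  ≺⇒¬≽ β∈O γ∈O γ≺β (inj₂ refl) = ≺-irrefl β∈O γ≺β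

  ¬≼⇒≻ : ∀ {β γ} → InO β → InO γ → ¬ (β ≼ γ) → γ ≺ β
  ¬≼⇒≻ β∈O γ∈O β⋠γ with ≺-tri β∈O γ∈O
  ... | inj₁ β≺γ        = ⊥-elim (β⋠γ (inj₁ β≺γ))
  ... | inj₂ (inj₁ β≡γ) = ⊥-elim (β⋠γ (inj₂ β≡γ))
  ... | inj₂ (inj₂ γ≺β) = γ≺β

  ≺-≼-trans : ∀ {β γ δ} → InO β → InO γ → InO δ → β ≺ γ → γ ≼ δ → β ≺ δ
  ≺-≼-trans β∈O γ∈O δ∈O β≺γ (inj₁ γ≺δ) = ≺-trans β∈O γ∈O δ∈O β≺γ γ≺δ
  ≺-≼-trans β∈O γ∈O δ∈O β≺γ (inj₂ refl) = β≺γ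

  ≼-≺-trans : ∀ {β γ δ} → InO β → InO γ → InO δ → β ≼ γ → γ ≺ δ → β ≺ δ
  ≼-≺-trans β∈O γ∈O δ∈O (inj₁ β≺γ) γ≺δ = ≺-trans β∈O γ∈O δ∈O β≺γ γ≺δ
  ≼-≺-trans β∈O γ∈O δ∈O (inj₂ refl) γ≺δ = γ≺δ

  ≼-⊕ʳ : ∀ {β γ} → InO β → InO γ → β ≼ (β ⊕ γ)
  ≼-⊕ʳ {β} β∈O γ∈O with 0-least γ∈O
  ... | inj₁ 0≺γ = inj₁ (subst (_≺ (β ⊕ _)) (⊕-idʳ β∈O) (⊕-monoʳ β∈O 0-in γ∈O 0≺γ))
  ... | inj₂ refl = inj₂ (sym (⊕-idʳ β∈O))

  ≼-⊕ˡ : ∀ {β γ} → InO β → InO γ → γ ≼ (β ⊕ γ)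
  ≼-⊕ˡ {β} {γ} β∈O γ∈O = subst (_≼ (β ⊕ γ)) (⊕-idˡ γ∈O) (⊕-monoˡ γ∈O 0-in β∈O (0-least β∈O))

  -- If 1 were 0, then α = α ⊗ 1 = α ⊗ 0 = 0 for every α.
  0≺1 : ∀ {α} → InO α → 0O ≺ α → 0O ≺ 1O
  0≺1 {α} α∈O 0≺α with 0-least (ω^-in 0-in)
  ... | inj₁ 0≺1′ = 0≺1′
  ... | inj₂ 0≡1  = ⊥-elim (≺-irrefl 0-in (subst (0O ≺_) α≡0 0≺α))
    where
    α≡0 : α ≡ 0O
    α≡0 = trans (sym (⊗-idʳ α∈O)) (trans (cong (α ⊗_) (sym 0≡1)) (⊗-zeroʳ α∈O))

  0≺ω^ : ∀ {β} → 0O ≺ 1O → InO β → 0O ≺ (ω^ β)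
  0≺ω^ 0≺1′ β∈O = ≺-≼-trans 0-in (ω^-in 0-in) (ω^-in β∈O) 0≺1′ 1≼ω^β
    where
    1≼ω^β : 1O ≼ (ω^ _)
    1≼ω^β with 0-least β∈O
    ... | inj₁ 0≺β = inj₁ (ω^-mono 0-in β∈O 0≺β)
    ... | inj₂ refl = inj₂ refl

  χ≺ χ≼ : ℕ → ℕ → ℕ
  χ≺ β γ = proj₁ ≺-elem (β ∷ γ ∷ [])
  χ≼ β γ = χ≺ β γ * ((β ∸ γ) + (γ ∸ β))

  χ∈ : ℕ → ℕ
  χ∈ β = proj₁ InO-elem (β ∷ [])

  χ≼-elem : Elem₂ χ≼
  χ≼-elem =
    elem-by (app₂ χ≺-elem (var (# 0)) (var (# 1)) *ᵗ ((var (# 0) ∸ᵗ var (# 1)) +ᵗ (var (# 1) ∸ᵗ var (# 0))))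
                    λ { (β ∷ γ ∷ []) → refl }
    where
    χ≺-elem : Elem₂ χ≺
    χ≺-elem = e-ext (proj₁ (proj₂ ≺-elem)) λ { (β ∷ γ ∷ []) → refl }

  χ∈-elem : Elem₁ χ∈
  χ∈-elem = e-ext (proj₁ (proj₂ InO-elem)) λ { (β ∷ []) → refl }

  χ≼≡0⇒≼ : ∀ β γ → χ≼ β γ ≡ 0 → β ≼ γ
  χ≼≡0⇒≼ β γ χ≡0 with m*n≡0⇒m≡0∨n≡0 (χ≺ β γ) χ≡0
  ... | inj₁ χ≺≡0 = inj₁ (Equivalence.from (proj₂ (proj₂ ≺-elem) (β ∷ γ ∷ [])) χ≺≡0)
  ... | inj₂ d≡0  =
    inj₂ (≤-antisym (m∸n≡0⇒m≤n (m+n≡0⇒m≡0 (β ∸ γ) d≡0)) (m∸n≡0⇒m≤n (m+n≡0⇒n≡0 (β ∸ γ) d≡0)))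

  ≼⇒χ≼≡0 : ∀ β γ → β ≼ γ → χ≼ β γ ≡ 0
  ≼⇒χ≼≡0 β γ (inj₁ β≺γ) = cong (_* _) (Equivalence.to (proj₂ (proj₂ ≺-elem) (β ∷ γ ∷ [])) β≺γ)
  ≼⇒χ≼≡0 β β (inj₂ refl) = trans (cong (χ≺ β β *_) (cong₂ _+_ (n∸n≡0 β) (n∸n≡0 β))) (*-zeroʳ (χ≺ β β))

  -- Keeps the ordinal output of a step function in 𝕆 even on inputs that are not ordinals.
  guarded-ω^ : ℕ → ℕ
  guarded-ω^ β = if0 χ∈ β then ω^ β else 0O

  guarded-ω^-elem : Elem₁ guarded-ω^
  guarded-ω^-elem =
    elem-by (if0ᵗ app₁ χ∈-elem (var zero) then app₁ ω^-elem (var zero) else lit 0O) λ { (β ∷ []) → refl }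

  guarded-ω^-∈ : ∀ β → InO (guarded-ω^ β)
  guarded-ω^-∈ β with χ∈ β in χ≡
  ... | zero  = ω^-in (Equivalence.from (proj₂ (proj₂ InO-elem) (β ∷ [])) χ≡)
  ... | suc _ = 0-in

  guarded-ω^-≡ : ∀ {β} → InO β → guarded-ω^ β ≡ (ω^ β)
  guarded-ω^-≡ {β} β∈O =
    cong (if0_then ω^ β else 0O) (Equivalence.to (proj₂ (proj₂ InO-elem) (β ∷ [])) β∈O)

  dr-cong : ∀ {k} {f g : Vec ℕ k → ℕ} → DR O k f → (∀ x → f x ≡ g x) → DR O k g
  dr-cong (dr-elem e) f≗g = dr-elem (e-ext e f≗g)
  dr-cong (dr-D {g0y = g0y} {g0o} {g1y} {g1o} {g2} α α∈O d0y d0o d1y d1o d2 c0 c1 dv) f≗g =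
    dr-D α α∈O d0y d0o d1y d1o d2 c0 c1 (λ x → subst (DValue O g0y g0o g1y g1o g2 x) (f≗g x) (dv x))

  height : ∀ {k f} → DR O k f → ℕ
  height (dr-elem _) = 0
  height (dr-D _ _ d0y d0o d1y d1o d2 _ _ _) =
    suc (height d0y ⊔ height d0o ⊔ height d1y ⊔ height d1o ⊔ height d2)

  module _ {k n} {g0y g0o : Vec ℕ k → ℕ} {g1y g1o : Vec ℕ (k + 2) → ℕ}
           {h0y h0o : Vec ℕ n → ℕ} {h1y h1o : Vec ℕ (n + 2) → ℕ}
           (x : Vec ℕ k) (p : Vec ℕ n) (enc : ℕ → ℕ) where

    DSeq-simulation :
      g0y x ≡ enc (h0y p) → g0o x ≡ h0o p →
      (∀ y β → g1y (x ++ enc y ∷ β ∷ []) ≡ enc (h1y (p ++ y ∷ β ∷ []))) →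
      (∀ y β → g1o (x ++ enc y ∷ β ∷ []) ≡ h1o (p ++ y ∷ β ∷ [])) →
      ∀ i → DSeq O g0y g0o g1y g1o x i ≡ map₁ enc (DSeq O h0y h0o h1y h1o p i)
    DSeq-simulation e0y e0o e1y e1o zero    = cong₂ _,_ e0y e0o
    DSeq-simulation e0y e0o e1y e1o (suc i) =
      trans (cong (λ (y , β) → g1y (x ++ y ∷ β ∷ []) , g1o (x ++ y ∷ β ∷ []))
                  (DSeq-simulation e0y e0o e1y e1o i))
            (cong₂ _,_ (e1y _ _) (e1o _ _))

    DValue-simulation : ∀ {g2 h2 : Vec ℕ 1 → ℕ} (post : ℕ → ℕ) →
      (∀ i → DSeq O g0y g0o g1y g1o x i ≡ map₁ enc (DSeq O h0y h0o h1y h1o p i)) →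
      (∀ y → g2 (enc y ∷ []) ≡ post (h2 (y ∷ []))) →
      ∀ {v} → DValue O h0y h0o h1y h1o h2 p v → DValue O g0y g0o g1y g1o g2 x (post v)
    DValue-simulation {g2} post seq out (s , minimal , stops , v≡) =
      s , (λ i i<s → minimal i i<s ∘ subst₂ _≼_ (ord i) (ord (suc i))) ,
      subst₂ _≼_ (sym (ord s)) (sym (ord (suc s))) stops ,
      trans (cong post v≡) (trans (sym (out _)) (cong (λ y → g2 (y ∷ [])) (sym (cong proj₁ (seq s)))))
      where
      ord : ∀ i → proj₂ (DSeq O g0y g0o g1y g1o x i) ≡ proj₂ (DSeq O h0y h0o h1y h1o p i)
      ord i = cong proj₂ (seq i)

  lift₂ : ∀ {k m} → (Vec ℕ k → Vec ℕ m) → Vec ℕ (k + 2) → Vec ℕ (m + 2)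
  lift₂ h X = h (args X) ++ state X ∷ ordinal X ∷ []

  lift₂-elem : ∀ {k m} {h : Vec ℕ k → Vec ℕ m} →
               ElemMap k m h → ElemMap (k + 2) (m + 2) (lift₂ h)
  lift₂-elem eh = ++-elem (∘-elem eh args-elem) (∷-elem state-elem (∷-elem ordinal-elem []-elem))

  lift₂-++ : ∀ {k m} (h : Vec ℕ k → Vec ℕ m) x y β → lift₂ h (x ++ y ∷ β ∷ []) ≡ h x ++ y ∷ β ∷ []
  lift₂-++ h x y β =
    cong₂ (λ a w → h a ++ w) (args-++ x y β)
          (cong₂ (λ b c → b ∷ c ∷ []) (state-++ x y β) (ordinal-++ x y β))

  dr-∘ : ∀ {k m} {F : Vec ℕ m → ℕ} {h : Vec ℕ k → Vec ℕ m} →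
         DR O m F → ElemMap k m h → DR O k (F ∘ h)
  dr-∘ (dr-elem e) eh = dr-elem (elem-∘ e eh)
  dr-∘ {h = h} (dr-D {g0y = g0y} {g0o} {g1y} {g1o} {g2} α α∈O d0y d0o d1y d1o d2 c0 c1 dv) eh =
    dr-D α α∈O (dr-∘ d0y eh) (dr-∘ d0o eh) (dr-∘ d1y (lift₂-elem eh)) (dr-∘ d1o (lift₂-elem eh))
      d2
      (c0 ∘ h)
      (λ x y β β∈O → subst (InO ∘ g1o) (sym (lift₂-++ h x y β)) (c1 (h x) y β β∈O))
      (λ x → DValue-simulation x (h x) id {g2 = g2} {h2 = g2} id
               (DSeq-simulation x (h x) id refl refl (λ y β → cong g1y (lift₂-++ h x y β))
                                                     (λ y β → cong g1o (lift₂-++ h x y β)))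
               (λ y → refl) (dv (h x)))

  height-dr-∘ : ∀ {k m} {F : Vec ℕ m → ℕ} {h : Vec ℕ k → Vec ℕ m}
                (d : DR O m F) (eh : ElemMap k m h) → height (dr-∘ d eh) ≡ height d
  height-dr-∘ (dr-elem e) eh = refl
  height-dr-∘ (dr-D α α∈O d0y d0o d1y d1o d2 c0 c1 dv) eh =
    cong suc (cong₂ _⊔_ (cong₂ _⊔_ (cong₂ _⊔_ (cong₂ _⊔_ (height-dr-∘ d0y eh) (height-dr-∘ d0o eh))
                                              (height-dr-∘ d1y _)) (height-dr-∘ d1o _)) refl)

  DR< : ℕ → (k : ℕ) → (Vec ℕ k → ℕ) → Set
  DR< n k f = Σ (DR O k f) λ d → height d < n

  dr-∘< : ∀ {n k m} {F : Vec ℕ m → ℕ} {h : Vec ℕ k → Vec ℕ m} →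
          DR< n m F → ElemMap k m h → DR< n k (F ∘ h)
  dr-∘< (d , d<n) eh = dr-∘ d eh , subst (_< _) (sym (height-dr-∘ d eh)) d<n

  record Scheme (n k : ℕ) (F : Vec ℕ k → ℕ) : Set where
    field
      α   : ℕ
      α∈O : InO α
      {g0y g0o} : Vec ℕ k → ℕ
      {g1y g1o} : Vec ℕ (k + 2) → ℕ
      {g2} : Vec ℕ 1 → ℕ
      d0y : DR< n k g0y
      d0o : DR< n k g0o
      d1y : DR< n (k + 2) g1y
      d1o : DR< n (k + 2) g1o
      d2  : DR< n 1 g2
      init-bounded : ∀ x → InO (g0o x) × (g0o x ≺ α)
      step-closed  : ∀ x y β → InO β → InO (g1o (x ++ y ∷ β ∷ []))
      value        : ∀ x → DValue O g0y g0o g1y g1o g2 x (F x)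

    α-positive : 0O ≺ α
    α-positive =
      uncurry (λ β∈O β≺α → ≼-≺-trans 0-in β∈O α∈O (0-least β∈O) β≺α) (init-bounded (replicate k 0))

    n-positive : 0 < n
    n-positive = ≤-trans (s≤s z≤n) (proj₂ d0y)

  view : ∀ {n k F} (d : DR O k F) → height d ≤ n → Elem k F ⊎ Scheme n k F
  view (dr-elem e) _ = inj₁ e
  view (dr-D α α∈O d0y d0o d1y d1o d2 c0 c1 dv) d≤n =
    let rest₃ = m⊔n<o⇒m<o _ _ d≤n
        rest₂ = m⊔n<o⇒m<o _ _ rest₃
        rest₁ = m⊔n<o⇒m<o _ _ rest₂
    in inj₂ record
      { α = α ; α∈O = α∈O
      ; d0y = d0y , m⊔n<o⇒m<o _ _ rest₁ ; d0o = d0o , m⊔n<o⇒n<o _ _ rest₁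
      ; d1y = d1y , m⊔n<o⇒n<o _ _ rest₂ ; d1o = d1o , m⊔n<o⇒n<o _ _ rest₃ ; d2 = d2 , m⊔n<o⇒n<o _ _ d≤n
      ; init-bounded = c0 ; step-closed = c1 ; value = dv }

  trivial : ∀ {n k F α} → InO α → 0O ≺ α → 0 < n → Elem k F → Scheme n k F
  trivial {α = α} α∈O 0≺α 0<n eF = record
    { α = α ; α∈O = α∈O
    ; d0y = dr-elem eF , 0<n ; d0o = dr-elem (const-elem 0O) , 0<n
    ; d1y = dr-elem state-elem , 0<n ; d1o = dr-elem (const-elem 0O) , 0<n ; d2 = dr-elem (e-proj zero) , 0<n
    ; init-bounded = λ _ → 0-in , 0≺α
    ; step-closed = λ _ _ _ _ → 0-in
    ; value = λ _ → 0 , (λ _ ()) , inj₂ refl , refl }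

  -- Definition by cases

  Selection : ℕ → Set
  Selection n = ∀ {k} {c : Vec ℕ k → ℕ} {p q : Vec ℕ 1 → ℕ} {F G : Vec ℕ k → ℕ} →
                Elem k c → Elem 1 p → Elem 1 q → DR< n k F → DR< n k G →
                DR O k (λ x → if0 c x then p (F x ∷ []) else q (G x ∷ []))

  module Select {n k} {c : Vec ℕ k → ℕ} {p q : Vec ℕ 1 → ℕ} {F G : Vec ℕ k → ℕ}
                (IH : Selection n) (ec : Elem k c) (ep : Elem 1 p) (eq : Elem 1 q)
                (A : Scheme n k F) (B : Scheme n k G) where
    private
      module A = Scheme A
      module B = Scheme B

    untag : Vec ℕ (k + 2) → Vec ℕ (k + 2)
    untag X = args X ++ unpair₂ (state X) ∷ ordinal X ∷ []

    untag-elem : ElemMap (k + 2) (k + 2) untag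
    untag-elem = ++-elem args-elem (∷-elem (elem-∘ unpair₂-elem (∷-elem state-elem []-elem))
                                           (∷-elem ordinal-elem []-elem))

    untag-++ : ∀ x z β → untag (x ++ z ∷ β ∷ []) ≡ x ++ unpair₂ z ∷ β ∷ []
    untag-++ x z β = cong₂ _++_ (args-++ x z β)
      (cong₂ (λ y γ → y ∷ γ ∷ []) (cong unpair₂ (state-++ x z β)) (ordinal-++ x z β))

    untag-pair : ∀ x t y β → untag (x ++ pair t y ∷ β ∷ []) ≡ x ++ y ∷ β ∷ []
    untag-pair x t y β =
      trans (untag-++ x (pair t y) β) (cong (λ y′ → x ++ y′ ∷ β ∷ []) (unpair₂-pair t y))

    g0y g0o : Vec ℕ k → ℕ
    g0y x = if0 c x then pair 0 (A.g0y x) else pair 1 (B.g0y x)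
    g0o x = if0 c x then A.g0o x else B.g0o x

    g1y g1o : Vec ℕ (k + 2) → ℕ
    g1y X = if0 c (args X) then pair 0 (A.g1y (untag X)) else pair 1 (B.g1y (untag X))
    g1o X = if0 c (args X) then A.g1o (untag X) else B.g1o (untag X)

    g2 : Vec ℕ 1 → ℕ
    g2 w = if0 unpair₁ (head w) then p (A.g2 (unpair₂ (head w) ∷ []) ∷ [])
           else q (B.g2 (unpair₂ (head w) ∷ []) ∷ [])

    g1y-pair : ∀ x t y β → g1y (x ++ pair t y ∷ β ∷ []) ≡
               (if0 c x then pair 0 (A.g1y (x ++ y ∷ β ∷ [])) else pair 1 (B.g1y (x ++ y ∷ β ∷ [])))
    g1y-pair x t y β = cong₂ (λ a X → if0 c a then pair 0 (A.g1y X) else pair 1 (B.g1y X))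
                             (args-++ x _ β) (untag-pair x t y β)

    g1o-pair : ∀ x t y β → g1o (x ++ pair t y ∷ β ∷ []) ≡
               (if0 c x then A.g1o (x ++ y ∷ β ∷ []) else B.g1o (x ++ y ∷ β ∷ []))
    g1o-pair x t y β =
      cong₂ (λ a X → if0 c a then A.g1o X else B.g1o X) (args-++ x _ β) (untag-pair x t y β)

    g2-pair : ∀ t y →
              g2 (pair t y ∷ []) ≡ (if0 t then p (A.g2 (y ∷ []) ∷ []) else q (B.g2 (y ∷ []) ∷ []))
    g2-pair t y = cong₂ (λ t′ y′ → if0 t′ then p (A.g2 (y′ ∷ []) ∷ []) else q (B.g2 (y′ ∷ []) ∷ []))
                        (unpair₁-pair t y) (unpair₂-pair t y)

    α : ℕ
    α = A.α ⊕ B.α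

    α∈O : InO α
    α∈O = ⊕-in A.α∈O B.α∈O

    init-bounded : ∀ x → InO (g0o x) × (g0o x ≺ α)
    init-bounded x = if0-elim (λ β → InO β × β ≺ α) (c x)
      (a₀∈O , ≺-≼-trans a₀∈O A.α∈O α∈O (proj₂ (A.init-bounded x)) (≼-⊕ʳ A.α∈O B.α∈O))
      (b₀∈O , ≺-≼-trans b₀∈O B.α∈O α∈O (proj₂ (B.init-bounded x)) (≼-⊕ˡ A.α∈O B.α∈O))
      where
      a₀∈O : InO (A.g0o x)
      a₀∈O = proj₁ (A.init-bounded x)
      b₀∈O : InO (B.g0o x)
      b₀∈O = proj₁ (B.init-bounded x)

    step-closed : ∀ x y β → InO β → InO (g1o (x ++ y ∷ β ∷ []))
    step-closed x y β β∈O =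
      subst InO (sym (cong₂ (λ a X → if0 c a then A.g1o X else B.g1o X) (args-++ x y β) (untag-++ x y β)))
            (if0-elim InO (c x) (A.step-closed x (unpair₂ y) β β∈O)
                                (B.step-closed x (unpair₂ y) β β∈O))

    value : ∀ x → DValue O g0y g0o g1y g1o g2 x (if0 c x then p (F x ∷ []) else q (G x ∷ []))
    value x with c x in cx
    ... | zero  = DValue-simulation x x (pair 0) {g2 = g2} {h2 = A.g2} (λ v → p (v ∷ []))
        (DSeq-simulation x x (pair 0) (if0-zero cx) (if0-zero cx)
           (λ y β → trans (g1y-pair x 0 y β) (if0-zero cx))
           (λ y β → trans (g1o-pair x 0 y β) (if0-zero cx)))
        (g2-pair 0) (A.value x)
    ... | suc _ = DValue-simulation x x (pair 1) {g2 = g2} {h2 = B.g2} (λ v → q (v ∷ []))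
        (DSeq-simulation x x (pair 1) (if0-≢0 c≢0) (if0-≢0 c≢0)
           (λ y β → trans (g1y-pair x 1 y β) (if0-≢0 c≢0))
           (λ y β → trans (g1o-pair x 1 y β) (if0-≢0 c≢0)))
        (g2-pair 1) (B.value x)
      where
      c≢0 : ¬ (c x ≡ 0)
      c≢0 c≡0 with () ← trans (sym cx) c≡0

    tag-elem : ∀ t → Elem 1 (λ v → pair t (head v))
    tag-elem t = elem-by (app₂ pair-elem (lit t) (var zero)) λ { (y ∷ []) → refl }

    dr : DR O k (λ x → if0 c x then p (F x ∷ []) else q (G x ∷ []))
    dr = dr-D α α∈O g0y-dr g0o-dr g1y-dr g1o-dr g2-dr init-bounded step-closed value
      where
      g0y-dr : DR O k g0y
      g0y-dr = IH ec (tag-elem 0) (tag-elem 1) A.d0y B.d0y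
      g0o-dr : DR O k g0o
      g0o-dr = IH ec (e-proj zero) (e-proj zero) A.d0o B.d0o
      g1y-dr : DR O (k + 2) g1y
      g1y-dr = IH (elem-∘ ec args-elem) (tag-elem 0) (tag-elem 1)
                  (dr-∘< A.d1y untag-elem) (dr-∘< B.d1y untag-elem)
      g1o-dr : DR O (k + 2) g1o
      g1o-dr = IH (elem-∘ ec args-elem) (e-proj zero) (e-proj zero)
                  (dr-∘< A.d1o untag-elem) (dr-∘< B.d1o untag-elem)
      g2-dr : DR O 1 g2
      g2-dr = IH unpair₁-elem ep eq (dr-∘< A.d2 (∷-elem unpair₂-elem []-elem))
                                    (dr-∘< B.d2 (∷-elem unpair₂-elem []-elem))

  dr-if0< : ∀ n → Selection n
  dr-if0< zero _ _ _ (_ , ()) _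
  dr-if0< (suc n) ec ep eq (dF , F<) (dG , G<) with view dF (≤-pred F<) | view dG (≤-pred G<)
  ... | inj₁ eF | inj₁ eG = dr-elem (elem-∘ if0-elem
          (∷-elem ec (∷-elem (elem-∘ ep (∷-elem eF []-elem))
                     (∷-elem (elem-∘ eq (∷-elem eG []-elem)) []-elem))))
  ... | inj₁ eF | inj₂ B  = Select.dr (dr-if0< n) ec ep eq (trivial B.α∈O B.α-positive B.n-positive eF) B
    where module B = Scheme B
  ... | inj₂ A  | inj₁ eG = Select.dr (dr-if0< n) ec ep eq A (trivial A.α∈O A.α-positive A.n-positive eG)
    where module A = Scheme A
  ... | inj₂ A  | inj₂ B  = Select.dr (dr-if0< n) ec ep eq A B

  dr-if0 : ∀ {k} {c : Vec ℕ k → ℕ} {p q : Vec ℕ 1 → ℕ} {F G : Vec ℕ k → ℕ} →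
           Elem k c → Elem 1 p → Elem 1 q → DR O k F → DR O k G →
           DR O k (λ x → if0 c x then p (F x ∷ []) else q (G x ∷ []))
  dr-if0 ec ep eq dF dG =
    dr-if0< (suc (height dF ⊔ height dG)) ec ep eq (dF , s≤s (m≤m⊔n _ _)) (dG , s≤s (m≤n⊔m _ _))

  -- Substitution and composition

  Substitution : ℕ → Set
  Substitution n = ∀ {k} {H : Vec ℕ (suc k) → ℕ} {g : Vec ℕ k → ℕ} →
                   DR O (suc k) H → DR< n k g → DR O k (λ x → H (g x ∷ x))

  next-ordinal : ℕ → ℕ → ℕ
  next-ordinal β β′ = if0 χ≼ β β′ then 0O else guarded-ω^ β′

  next-ordinal-elem : Elem₂ next-ordinal
  next-ordinal-elem =
    elem-by (if0ᵗ app₂ χ≼-elem (var (# 0)) (var (# 1)) then lit 0O else app₁ guarded-ω^-elem (var (# 1)))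
            λ { (β ∷ β′ ∷ []) → refl }

  next-ordinal-∈ : ∀ β β′ → InO (next-ordinal β β′)
  next-ordinal-∈ β β′ = if0-elim InO (χ≼ β β′) 0-in (guarded-ω^-∈ β′)

  module Substitute {n k} {H : Vec ℕ (suc k) → ℕ} {g : Vec ℕ k → ℕ}
                    (IH : Substitution n) (dH : DR O (suc k) H) (S : Scheme n k g) where
    private
      module S = Scheme S

    step-y step-o : Vec ℕ k → ℕ → ℕ → ℕ
    step-y x y β = if0 χ≼ β (S.g1o (x ++ y ∷ β ∷ [])) then H (S.g2 (y ∷ []) ∷ x)
                   else pair (S.g1y (x ++ y ∷ β ∷ [])) (S.g1o (x ++ y ∷ β ∷ []))
    step-o x y β = next-ordinal β (S.g1o (x ++ y ∷ β ∷ []))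

    decode : Vec ℕ (k + 2) → Vec ℕ k × ℕ × ℕ
    decode X = args X , unpair₁ (state X) , unpair₂ (state X)

    decode-pair : ∀ x y β γ → decode (x ++ pair y β ∷ γ ∷ []) ≡ (x , y , β)
    decode-pair x y β γ = cong₂ _,_ (args-++ x _ γ)
      (cong₂ _,_ (trans (cong unpair₁ (state-++ x _ γ)) (unpair₁-pair y β))
                 (trans (cong unpair₂ (state-++ x _ γ)) (unpair₂-pair y β)))

    unpack : Vec ℕ (k + 2) → Vec ℕ (k + 2)
    unpack X = args X ++ unpair₁ (state X) ∷ unpair₂ (state X) ∷ []

    unpack-elem : ElemMap (k + 2) (k + 2) unpack
    unpack-elem = ++-elem args-elem
      (∷-elem (of-state unpair₁ unpair₁-elem) (∷-elem (of-state unpair₂ unpair₂-elem) []-elem))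
      where
      of-state : ∀ (f : ℕ → ℕ) → Elem₁ f → Elem (k + 2) (λ X → f (state X))
      of-state f ef = elem-∘ ef (∷-elem state-elem []-elem)

    h0y h0o : Vec ℕ k → ℕ
    h0y x = pair (S.g0y x) (S.g0o x)
    h0o x = ω^ (S.g0o x)

    h1y h1o : Vec ℕ (k + 2) → ℕ
    h1y X = step-y (args X) (unpair₁ (state X)) (unpair₂ (state X))
    h1o X = step-o (args X) (unpair₁ (state X)) (unpair₂ (state X))

    h2 : Vec ℕ 1 → ℕ
    h2 v = lookup v zero

    module Run (x : Vec ℕ k) where
      Y B : ℕ → ℕ
      Y i = proj₁ (DSeq O S.g0y S.g0o S.g1y S.g1o x i)
      B i = proj₂ (DSeq O S.g0y S.g0o S.g1y S.g1o x i)

      s : ℕ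
      s = proj₁ (S.value x)

      descending : ∀ i → i < s → ¬ (B i ≼ B (suc i))
      descending = proj₁ (proj₂ (S.value x))

      stops : B s ≼ B (suc s)
      stops = proj₁ (proj₂ (proj₂ (S.value x)))

      g≡ : g x ≡ S.g2 (Y s ∷ [])
      g≡ = proj₂ (proj₂ (proj₂ (S.value x)))

      B∈O : ∀ i → InO (B i)
      B∈O zero    = proj₁ (S.init-bounded x)
      B∈O (suc i) = S.step-closed x (Y i) (B i) (B∈O i)

      D : ℕ → ℕ × ℕ
      D j = DSeq O h0y h0o h1y h1o x j

      D-step : ∀ j y β → proj₁ (D j) ≡ pair y β → D (suc j) ≡ (step-y x y β , step-o x y β)
      D-step j y β Dj≡ =
        cong (λ (x′ , y′ , β′) → step-y x′ y′ β′ , step-o x′ y′ β′)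
             (trans (cong (λ z → decode (x ++ z ∷ proj₂ (D j) ∷ [])) Dj≡) (decode-pair x y β _))

      tracks : ∀ j → j ≤ s → D j ≡ (pair (Y j) (B j) , ω^ (B j))
      tracks zero    _   = refl
      tracks (suc j) j<s =
        trans (D-step j (Y j) (B j) (cong proj₁ (tracks j (<⇒≤ j<s))))
              (cong₂ _,_ (if0-≢0 continues) (trans (if0-≢0 continues) (guarded-ω^-≡ (B∈O (suc j)))))
        where
        continues : ¬ (χ≼ (B j) (B (suc j)) ≡ 0)
        continues = descending j j<s ∘ χ≼≡0⇒≼ (B j) (B (suc j))

      halts : D (suc s) ≡ (H (g x ∷ x) , 0O)
      halts = trans (D-step s (Y s) (B s) (cong proj₁ (tracks s ≤-refl)))
                    (cong₂ _,_ (trans (if0-zero stopped) (cong (λ v → H (v ∷ x)) (sym g≡)))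
                               (if0-zero stopped))
        where
        stopped : χ≼ (B s) (B (suc s)) ≡ 0
        stopped = ≼⇒χ≼≡0 (B s) (B (suc s)) stops

      ord : ℕ → ℕ
      ord j = proj₂ (D j)

      ord∈O : ∀ j → InO (ord j)
      ord∈O zero    = ω^-in (B∈O zero)
      ord∈O (suc j) = next-ordinal-∈ _ _

      ord-descends : ∀ j → j ≤ s → ord (suc j) ≺ ord j
      ord-descends j j≤s with m≤n⇒m<n∨m≡n j≤s
      ... | inj₁ j<s  = subst₂ _≺_ (sym (cong proj₂ (tracks (suc j) j<s))) (sym (cong proj₂ (tracks j j≤s)))
                          (ω^-mono (B∈O (suc j)) (B∈O j) (¬≼⇒≻ (B∈O j) (B∈O (suc j)) (descending j j<s)))
      ... | inj₂ refl = subst₂ _≺_ (sym (cong proj₂ halts)) (sym (cong proj₂ (tracks s j≤s)))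
                          (0≺ω^ (0≺1 S.α∈O S.α-positive) (B∈O s))

      value : DValue O h0y h0o h1y h1o h2 x (H (g x ∷ x))
      value = suc s
            , (λ j j≤s → ≺⇒¬≽ (ord∈O j) (ord∈O (suc j)) (ord-descends j (≤-pred j≤s)))
            , subst (_≼ ord (suc (suc s))) (sym (cong proj₂ halts)) (0-least (ord∈O (suc (suc s))))
            , sym (cong proj₁ halts)

    pairᵗ : ∀ {m} → Term (suc (suc m))
    pairᵗ = app₂ pair-elem (var (# 0)) (var (# 1))

    stateᵗ : Term (suc (k + 2))
    stateᵗ = var (suc (k ↑ʳ zero))

    continue : Vec ℕ (suc (k + 2)) → ℕ
    continue (β′ ∷ X) = if0 χ≼ (unpair₂ (state X)) β′
                        then H (S.g2 (unpair₁ (state X) ∷ []) ∷ args X)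
                        else pair (S.g1y (unpack X)) β′

    continue-dr : DR O (suc (k + 2)) continue
    continue-dr = dr-cong (dr-if0 (⟦⟧-elem (app₂ χ≼-elem (app₁ unpair₂-elem stateᵗ) (var zero)))
                                  (e-proj zero) (e-proj zero) output go-on)
                          λ { (β′ ∷ X) → refl }
      where
      output : DR O (suc (k + 2)) (λ v → H (S.g2 (unpair₁ (state (tail v)) ∷ []) ∷ args (tail v)))
      output = IH (dr-∘ dH (∷-elem (e-proj zero) (∘-elem args-elem (∘-elem tail-elem tail-elem))))
                  (dr-∘< S.d2 (∷-elem (elem-∘ unpair₁-elem (∷-elem (elem-∘ state-elem tail-elem) []-elem))
                                      []-elem))
      go-on : DR O (suc (k + 2)) (λ v → pair (S.g1y (unpack (tail v))) (head v))
      go-on = dr-cong (IH (dr-elem (⟦⟧-elem pairᵗ)) (dr-∘< S.d1y (∘-elem unpack-elem tail-elem)))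
                      λ { (β′ ∷ X) → refl }

    h0y-dr : DR O k h0y
    h0y-dr = IH (IH (dr-elem (⟦⟧-elem pairᵗ)) (dr-∘< S.d0y tail-elem)) S.d0o

    h0o-dr : DR O k h0o
    h0o-dr = IH (dr-elem (⟦⟧-elem (app₁ ω^-elem (var zero)))) S.d0o

    h1y-dr : DR O (k + 2) h1y
    h1y-dr = IH continue-dr (dr-∘< S.d1o unpack-elem)

    h1o-dr : DR O (k + 2) h1o
    h1o-dr = IH (dr-elem (⟦⟧-elem (app₂ next-ordinal-elem (app₁ unpair₂-elem stateᵗ) (var zero))))
                (dr-∘< S.d1o unpack-elem)

    init-bounded : ∀ x → InO (h0o x) × (h0o x ≺ (ω^ S.α))
    init-bounded x = ω^-in g0o∈O , ω^-mono g0o∈O S.α∈O (proj₂ (S.init-bounded x))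
      where
      g0o∈O : InO (S.g0o x)
      g0o∈O = proj₁ (S.init-bounded x)

    dr : DR O k (λ x → H (g x ∷ x))
    dr = dr-D (ω^ S.α) (ω^-in S.α∈O) h0y-dr h0o-dr h1y-dr h1o-dr (dr-elem (e-proj zero))
              init-bounded (λ _ _ _ _ → next-ordinal-∈ _ _) Run.value

  dr-subst< : ∀ n → Substitution n
  dr-subst< zero _ (_ , ())
  dr-subst< (suc n) dH (dg , g<) with view dg (≤-pred g<)
  ... | inj₁ eg = dr-∘ dH (∷-elem eg id-elem)
  ... | inj₂ S  = Substitute.dr (dr-subst< n) dH S

  dr-subst : ∀ {k} {H : Vec ℕ (suc k) → ℕ} {g : Vec ℕ k → ℕ} →
             DR O (suc k) H → DR O k g → DR O k (λ x → H (g x ∷ x))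
  dr-subst dH dg = dr-subst< (suc (height dg)) dH (dg , ≤-refl)

  move : ∀ n k → Vec ℕ (n + suc k) → Vec ℕ (suc (n + k))
  move n k v = lookup v (n ↑ʳ zero) ∷ (select (_↑ˡ suc k) v ++ select (λ j → n ↑ʳ suc j) v)

  move-elem : ∀ n k → ElemMap (n + suc k) (suc (n + k)) (move n k)
  move-elem n k =
    ∷-elem (e-proj (n ↑ʳ zero)) (++-elem (select-elem (_↑ˡ suc k)) (select-elem (λ j → n ↑ʳ suc j)))

  move-++ : ∀ {n k} (w : Vec ℕ n) u (x : Vec ℕ k) → move n k (w ++ u ∷ x) ≡ u ∷ (w ++ x)
  move-++ w u x = cong₂ _∷_ (lookup-++ʳ w (u ∷ x) zero)
    (cong₂ _++_ (select-↑ˡ-++ w (u ∷ x))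
                (trans (tabulate-cong (λ j → lookup-++ʳ w (u ∷ x) (suc j))) (tabulate∘lookup x)))

  dr-compose-++ : ∀ n {k} {F : Vec ℕ (n + k) → ℕ} (gs : Fin n → Vec ℕ k → ℕ) →
                  DR O (n + k) F → (∀ i → DR O k (gs i)) → DR O k (λ x → F (tabulate (λ i → gs i x) ++ x))
  dr-compose-++ zero    gs dF dgs = dF
  dr-compose-++ (suc n) {k} {F} gs dF dgs =
    dr-cong (dr-subst (dr-compose-++ n (λ i → gs (suc i) ∘ tail) (dr-∘ dF (move-elem n k))
                                       (λ i → dr-∘ (dgs (suc i)) tail-elem))
                      (dgs zero))
            (λ x → cong F (move-++ (tabulate (λ i → gs (suc i) x)) (gs zero x) x))

  dr-compose : ∀ {k m} {F : Vec ℕ m → ℕ} {gs : Fin m → Vec ℕ k → ℕ} →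
               DR O m F → (∀ i → DR O k (gs i)) → DR O k (λ x → F (tabulate (λ i → gs i x)))
  dr-compose {k} {m} {F} {gs} dF dgs =
    dr-cong (dr-compose-++ m gs (dr-∘ dF (select-elem (_↑ˡ k))) dgs)
            (λ x → cong F (select-↑ˡ-++ (tabulate (λ i → gs i x)) x))

mainTheorem18 : (O : OrdNotation) → ∀ {k m} (f : Vec ℕ m → ℕ) (gs : Fin m → Vec ℕ k → ℕ) →
                DR O m f → (∀ i → DR O k (gs i)) →
                DR O k (λ x → f (tabulate (λ i → gs i x)))
mainTheorem18 O f gs df dgs = Closure.dr-compose O df dgs
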